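{- Let $G$ be a group, $R$ a ring, $N$ a nilpotent ideal of $R$ of nilpotency index $k$, and $s$ the characteristic of the quotient ring $R/N$; let $RG$ denote the group ring. Then: (1) If $w$ is a natural number with $\bar x^{\,w}=\bar 1$ for all $\bar x\in ((R/N)G)^*$, then $x^{w s^{k-1}}=1$ for all $x\in (RG)^*$. (2) If $((R/N)G)^*$ is finite, then $x^{|((R/N)G)^*|\, s^{k-1}}=1$ for all $x\in (RG)^*$. (3) If $(RG)^*$ is finite, then $x^{|((R/N)G)^*|\,|N|^{|G|}}=1$ for all $x\in (RG)^*$.
   Context: Rings are associative with identity; $S^*$ denotes the group of units of a ring $S$. The characteristic of a ring $S$ is the least positive integer $s$ with $s\cdot 1_S=0$. The nilpotency index of $N$ is the least $k$ with $N^k=\{0\}$. -}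

module Defs where

open import Level using (Level; _⊔_)
open import Data.Nat using (ℕ; zero; suc; _<_; _∸_)
open import Data.Fin using (Fin)
open import Data.Product using (Σ; _×_; _,_)
open import Data.Sum using (_⊎_)
open import Data.List using (List; []; _∷_; map; concatMap)
open import Data.Vec using (Vec)
import Data.Vec.Relation.Unary.All as VecAll
import Data.List.Relation.Unary.All as ListAll
open import Relation.Binary.Core using (Rel)
open import Relation.Binary.PropositionalEquality using (_≡_)
open import Relation.Nullary using (¬_)
open import Relation.Unary using (Pred)
open import Algebra.Core using (Op₂)
open import Algebra.Bundles using (Ring; Group)

HasCard : ∀ {a ℓ p} {A : Set a} (_≈_ : Rel A ℓ) (P : Pred A p) (n : ℕ) →
          Set (a ⊔ ℓ ⊔ p)
HasCard {A = A} _≈_ P n =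
  Σ (Fin n → A) λ f →
    (∀ i → P (f i)) ×
    (∀ i j → f i ≈ f j → i ≡ j) ×
    (∀ x → P x → Σ (Fin n) λ i → f i ≈ x)

Finite : ∀ {a ℓ p} {A : Set a} (_≈_ : Rel A ℓ) (P : Pred A p) → Set (a ⊔ ℓ ⊔ p)
Finite _≈_ P = Σ ℕ λ n → HasCard _≈_ P n

-- Elements are finite formal
-- sums  Σ r_i g_i , represented by lists of pairs (r_i , g_i), identified
-- by the congruence generated by reordering, merging equal group
-- elements, dropping zero coefficients, and the equalities of A and G.

module GroupRingOn {a ℓa g ℓg}
  (A : Set a) (_≈A_ : Rel A ℓa) (_+A_ _*A_ : Op₂ A) (0A 1A : A)
  (G : Set g) (_≈G_ : Rel G ℓg) (_∙_ : Op₂ G) (e : G) where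

  Elem : Set (a ⊔ g)
  Elem = List (A × G)

  infix 4 _∼_
  data _∼_ : Elem → Elem → Set (a ⊔ ℓa ⊔ g ⊔ ℓg) where
    ∼-refl  : ∀ {xs} → xs ∼ xs
    ∼-sym   : ∀ {xs ys} → xs ∼ ys → ys ∼ xs
    ∼-trans : ∀ {xs ys zs} → xs ∼ ys → ys ∼ zs → xs ∼ zs
    ∼-cons  : ∀ {r r' h h' xs ys} → r ≈A r' → h ≈G h' → xs ∼ ys →
              ((r , h) ∷ xs) ∼ ((r' , h') ∷ ys)
    ∼-swap  : ∀ {p q xs} → (p ∷ q ∷ xs) ∼ (q ∷ p ∷ xs)
    ∼-merge : ∀ {r r' h xs} → ((r , h) ∷ (r' , h) ∷ xs) ∼ ((r +A r' , h) ∷ xs)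
    ∼-zero  : ∀ {h xs} → ((0A , h) ∷ xs) ∼ xs

  _·_ : Elem → Elem → Elem
  xs · ys = concatMap (λ { (r , h) → map (λ { (r' , h') → (r *A r' , h ∙ h') }) ys }) xs

  one : Elem
  one = (1A , e) ∷ []

  _^_ : Elem → ℕ → Elem
  x ^ zero  = one
  x ^ suc n = x · (x ^ n)

  IsUnit : Pred Elem (a ⊔ ℓa ⊔ g ⊔ ℓg)
  IsUnit x = Σ Elem λ y → (x · y ∼ one) × (y · x ∼ one)

module CharOn {a ℓa} (A : Set a) (_≈A_ : Rel A ℓa) (_+A_ : Op₂ A) (0A 1A : A) where

  natMul : ℕ → A
  natMul zero    = 0A
  natMul (suc n) = 1A +A natMul n

  IsCharacteristic : ℕ → Set ℓa
  IsCharacteristic s =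
    (0 < s × natMul s ≈A 0A × (∀ m → 0 < m → m < s → ¬ (natMul m ≈A 0A)))
    ⊎ (s ≡ 0 × (∀ m → 0 < m → ¬ (natMul m ≈A 0A)))

module RingNotions {c ℓ} (R : Ring c ℓ) where
  open Ring R

  record IsIdeal {p} (N : Pred Carrier p) : Set (c ⊔ ℓ ⊔ p) where
    field
      resp  : ∀ {x y} → x ≈ y → N x → N y
      zero∈ : N 0#
      +∈    : ∀ {x y} → N x → N y → N (x + y)
      -∈    : ∀ {x} → N x → N (- x)
      *ˡ∈   : ∀ r {x} → N x → N (r * x)
      *ʳ∈   : ∀ r {x} → N x → N (x * r)

  -- equality of the quotient ring R/N :  x̄ = ȳ  iff  x - y ∈ N
  _≈/_ : ∀ {p} → Pred Carrier p → Rel Carrier p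
  _≈/_ N x y = N (x - y)

  prodVec : ∀ {k} → Vec Carrier k → Carrier
  prodVec Vec.[] = 1#
  prodVec (x Vec.∷ xs) = x * prodVec xs

  sumList : List Carrier → Carrier
  sumList [] = 0#
  sumList (x ∷ xs) = x + sumList xs

  InPow : ∀ {p} → Pred Carrier p → ℕ → Pred Carrier (c ⊔ ℓ ⊔ p)
  InPow N k x =
    Σ (List (Vec Carrier k)) λ L →
      ListAll.All (VecAll.All N) L × (x ≈ sumList (map prodVec L))

  PowZero : ∀ {p} → Pred Carrier p → ℕ → Set (c ⊔ ℓ ⊔ p)
  PowZero N k = ∀ x → InPow N k x → x ≈ 0#

  IsNilpotencyIndex : ∀ {p} → Pred Carrier p → ℕ → Set (c ⊔ ℓ ⊔ p)
  IsNilpotencyIndex N k = PowZero N k × (∀ j → j < k → ¬ PowZero N j)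

module Setup {c ℓ g ℓg p} (G : Group g ℓg) (R : Ring c ℓ) (N : Pred (Ring.Carrier R) p) where
  open Ring R
  open RingNotions R
  private module G = Group G

  module RG = GroupRingOn Carrier _≈_ _+_ _*_ 0# 1# G.Carrier G._≈_ G._∙_ G.ε
  module QG = GroupRingOn Carrier (N ≈/_) _+_ _*_ 0# 1# G.Carrier G._≈_ G._∙_ G.ε
  module CharQ = CharOn Carrier (N ≈/_) _+_ 0# 1#

{-# OPTIONS --safe #-}
-- A unit x of RG maps to a unit of (R/N)G, so x^w ≡ 1 modulo NG: x^w = 1 + y with the
-- coefficients of y in N. If they lie in N^j (j ≥ 1), then (1 + y)^s = 1 + s·y + (terms with
-- coefficients in N^(j+1)), and s·1 ∈ N since s is the characteristic of R/N; so raising to the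
-- s-th power pushes x^w one step down the filtration, and k - 1 steps reach N^k = 0.
-- Lagrange's theorem in ((R/N)G)* supplies w = |((R/N)G)*|. When N and G are finite, 1 + NG is
-- a group of units (geometric series in -y) with |N|^|G| elements, and Lagrange's theorem applied
-- to x^w in it gives the exponent w·|N|^|G|. Lagrange's theorem for an element y of a finite group
-- is proved by counting the orbits of left multiplication by y, each of size the order of y.
module Submission where

open import Defs
open import Level using (_⊔_)
open import Function using (id; _∘_; case_of_)
open import Data.Nat as ℕ using (ℕ; zero; suc; z≤n; s≤s; _∸_)
import Data.Nat.Properties as ℕₚ
open import Data.Nat.Divisibility using (_∣_; divides; ∣-refl; _∣0; ∣m∣n⇒∣m+n)
open import Data.Nat.Induction using (<-rec)
open import Data.Bool using (Bool; true; false; _∧_; _∨_; not; if_then_else_)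
import Data.Bool.Properties as Boolₚ
open import Data.Fin as Fin using (Fin; toℕ; finToFun; funToFin)
import Data.Fin.Properties as Finₚ
open import Data.Product using (Σ; _×_; _,_; proj₁; proj₂)
open import Data.Sum using (_⊎_; inj₁; inj₂; [_,_]′)
open import Data.Empty using (⊥; ⊥-elim)
open import Data.Unit.Polymorphic using (⊤; tt)
open import Data.List using (List; []; _∷_; _++_; concat; replicate; tabulate)
import Data.List.Properties as Listₚ
import Data.List.Relation.Unary.All as All
import Data.List.Relation.Unary.All.Properties as Allₚ
import Data.Vec as Vec
open import Data.Vec.Functional using (updateAt)
import Data.Vec.Functional.Properties as Vecₚ
import Data.Vec.Relation.Unary.All as VecAll
import Data.Vec.Relation.Unary.All.Properties as VecAllₚ
open import Relation.Nullary using (¬_; Dec; yes; no; does)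
open import Relation.Unary using (Pred)
open import Relation.Binary.Bundles using (Setoid)
open import Relation.Binary.PropositionalEquality as ≡ using (_≡_; _≢_)
import Relation.Binary.Reasoning.Setoid as SetoidReasoning
open import Algebra.Bundles using (Ring; Group)
import Algebra.Properties.Ring as RingProperties
import Algebra.Properties.CommutativeSemigroup as CommSemigroupProperties

-- Counting and orbits of a permutation

count : ∀ {n} → (Fin n → Bool) → ℕ
count {zero} S = 0
count {suc n} S = (if S Fin.zero then 1 else 0) ℕ.+ count (λ j → S (Fin.suc j))

module _ where
  open CommSemigroupProperties ℕₚ.+-commutativeSemigroup using (interchange)

  count-cong : ∀ {n} {S T : Fin n → Bool} → (∀ j → S j ≡ T j) → count S ≡ count T
  count-cong {zero} e = ≡.refl
  count-cong {suc n} e = ≡.cong₂ ℕ._+_ (≡.cong (if_then 1 else 0) (e Fin.zero)) (count-cong (λ j → e (Fin.suc j)))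

  count-∧-split : ∀ {n} (S T : Fin n → Bool) → count S ≡ count (λ j → S j ∧ T j) ℕ.+ count (λ j → S j ∧ not (T j))
  count-∧-split {zero} S T = ≡.refl
  count-∧-split {suc n} S T =
    ≡.trans (≡.cong₂ ℕ._+_ (split (S Fin.zero) (T Fin.zero)) (count-∧-split (λ j → S (Fin.suc j)) (λ j → T (Fin.suc j))))
      (interchange (if S Fin.zero ∧ T Fin.zero then 1 else 0) _ _ _)
    where
    split : ∀ a b → (if a then 1 else 0) ≡ (if a ∧ b then 1 else 0) ℕ.+ (if a ∧ not b then 1 else 0)
    split true true = ≡.refl
    split true false = ≡.refl
    split false b = ≡.refl

  count-∨-disjoint : ∀ {n} (S T : Fin n → Bool) → (∀ j → S j ∧ T j ≡ false) →
                     count (λ j → S j ∨ T j) ≡ count S ℕ.+ count T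
  count-∨-disjoint {zero} S T disjoint = ≡.refl
  count-∨-disjoint {suc n} S T disjoint =
    ≡.trans (≡.cong₂ ℕ._+_ (split (S Fin.zero) (T Fin.zero) (disjoint Fin.zero))
                           (count-∨-disjoint (λ j → S (Fin.suc j)) (λ j → T (Fin.suc j)) (λ j → disjoint (Fin.suc j))))
      (interchange (if S Fin.zero then 1 else 0) _ _ _)
    where
    split : ∀ a b → a ∧ b ≡ false → (if a ∨ b then 1 else 0) ≡ (if a then 1 else 0) ℕ.+ (if b then 1 else 0)
    split true false _ = ≡.refl
    split false b _ = ≡.refl

count-empty : ∀ {n} (S : Fin n → Bool) → (∀ j → S j ≢ true) → count S ≡ 0
count-empty {zero} S ∉S = ≡.refl
count-empty {suc n} S ∉S with S Fin.zero in eq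
... | true = ⊥-elim (∉S Fin.zero eq)
... | false = count-empty (λ j → S (Fin.suc j)) (λ j → ∉S (Fin.suc j))

count-full : ∀ n → count {n} (λ _ → true) ≡ n
count-full zero = ≡.refl
count-full (suc n) = ≡.cong suc (count-full n)

_==_ : ∀ {n} → Fin n → Fin n → Bool
Fin.zero == Fin.zero = true
Fin.zero == Fin.suc j = false
Fin.suc i == Fin.zero = false
Fin.suc i == Fin.suc j = i == j

==-refl : ∀ {n} (i : Fin n) → (i == i) ≡ true
==-refl Fin.zero = ≡.refl
==-refl (Fin.suc i) = ==-refl i

==⇒≡ : ∀ {n} (i j : Fin n) → (i == j) ≡ true → i ≡ j
==⇒≡ Fin.zero Fin.zero _ = ≡.refl
==⇒≡ (Fin.suc i) (Fin.suc j) e = ≡.cong Fin.suc (==⇒≡ i j e)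

count-singleton : ∀ {n} (i : Fin n) → count (i ==_) ≡ 1
count-singleton {suc n} Fin.zero = ≡.cong suc (count-empty {n} (λ _ → false) (λ _ ()))
count-singleton {suc n} (Fin.suc i) = count-singleton i

module Orbits {n} (π : Fin n → Fin n) (π-injective : ∀ {i j} → π i ≡ π j → i ≡ j) where

  iterate : ℕ → Fin n → Fin n
  iterate zero i = i
  iterate (suc t) i = π (iterate t i)

  orbitUpTo : Fin n → ℕ → Fin n → Bool
  orbitUpTo i zero j = false
  orbitUpTo i (suc m) j = orbitUpTo i m j ∨ (iterate m i == j)

  orbitUpTo-sound : ∀ i m j → orbitUpTo i m j ≡ true → Σ ℕ λ t → t ℕ.< m × iterate t i ≡ j
  orbitUpTo-sound i (suc m) j e with orbitUpTo i m j in e′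
  ... | true = let (t , t<m , πᵗi≡j) = orbitUpTo-sound i m j e′ in t , ℕₚ.m<n⇒m<1+n t<m , πᵗi≡j
  ... | false = m , ℕₚ.≤-refl , ==⇒≡ _ _ e

  orbitUpTo-complete : ∀ i m t → t ℕ.< m → orbitUpTo i m (iterate t i) ≡ true
  orbitUpTo-complete i (suc m) t t<1+m with ℕₚ.m≤n⇒m<n∨m≡n (ℕₚ.≤-pred t<1+m)
  ... | inj₁ t<m rewrite orbitUpTo-complete i m t t<m = ≡.refl
  ... | inj₂ ≡.refl rewrite ==-refl (iterate t i) = Boolₚ.∨-zeroʳ (orbitUpTo i t (iterate t i))

  Invariant : (Fin n → Bool) → Set
  Invariant S = ∀ j → S j ≡ true → S (π j) ≡ true

  iterate-invariant : ∀ {S} → Invariant S → ∀ t i → S i ≡ true → S (iterate t i) ≡ true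
  iterate-invariant inv zero i e = e
  iterate-invariant inv (suc t) i e = inv _ (iterate-invariant inv t i e)

  module Period (d : ℕ) (period : ∀ i → iterate (suc d) i ≡ i)
                (distinct : ∀ i t u → t ℕ.< u → u ℕ.< suc d → iterate t i ≢ iterate u i) where

    count-orbitUpTo : ∀ i m → m ℕ.≤ suc d → count (orbitUpTo i m) ≡ m
    count-orbitUpTo i zero _ = count-empty (orbitUpTo i zero) (λ _ ())
    count-orbitUpTo i (suc m) m<1+d = begin
        count (λ j → orbitUpTo i m j ∨ (iterate m i == j))
          ≡⟨ count-∨-disjoint _ _ disjoint ⟩
        count (orbitUpTo i m) ℕ.+ count (iterate m i ==_)
          ≡⟨ ≡.cong₂ ℕ._+_ (count-orbitUpTo i m (ℕₚ.<⇒≤ m<1+d)) (count-singleton (iterate m i)) ⟩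
        m ℕ.+ 1
          ≡⟨ ℕₚ.+-comm m 1 ⟩
        suc m ∎
      where
      open ≡.≡-Reasoning
      disjoint : ∀ j → orbitUpTo i m j ∧ (iterate m i == j) ≡ false
      disjoint j with orbitUpTo i m j in e₁ | iterate m i == j in e₂
      ... | false | _ = ≡.refl
      ... | true | false = ≡.refl
      ... | true | true =
        let (t , t<m , πᵗi≡j) = orbitUpTo-sound i m j e₁ in
        ⊥-elim (distinct i t m t<m m<1+d (≡.trans πᵗi≡j (≡.sym (==⇒≡ _ _ e₂))))

    orbit : Fin n → Fin n → Bool
    orbit i = orbitUpTo i (suc d)

    orbit-backward : ∀ i j → orbit i (π j) ≡ true → orbit i j ≡ true
    orbit-backward i j e with orbitUpTo-sound i (suc d) (π j) e
    ... | zero , _ , i≡πj =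
      ≡.subst (λ z → orbit i z ≡ true) (π-injective (≡.trans (period i) i≡πj)) (orbitUpTo-complete i (suc d) d ℕₚ.≤-refl)
    ... | suc t , s≤s t<d , πᵗ⁺¹i≡πj =
      ≡.subst (λ z → orbit i z ≡ true) (π-injective πᵗ⁺¹i≡πj) (orbitUpTo-complete i (suc d) t (ℕₚ.m<n⇒m<1+n t<d))

    remove-orbit : ∀ {S} → Invariant S → ∀ i → S i ≡ true →
                   Σ (Fin n → Bool) λ S′ → Invariant S′ × count S ≡ suc d ℕ.+ count S′
    remove-orbit {S} inv i Si = S′ , inv′ , count-S
      where
      S′ : Fin n → Bool
      S′ j = S j ∧ not (orbit i j)
      orbit⊆S : ∀ j → S j ∧ orbit i j ≡ orbit i j
      orbit⊆S j with orbit i j in e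
      ... | false = Boolₚ.∧-zeroʳ (S j)
      ... | true = let (t , _ , πᵗi≡j) = orbitUpTo-sound i (suc d) j e in
        ≡.cong (_∧ true) (≡.subst (λ z → S z ≡ true) πᵗi≡j (iterate-invariant inv t i Si))
      count-S : count S ≡ suc d ℕ.+ count S′
      count-S = ≡.trans (count-∧-split S (orbit i))
        (≡.cong (ℕ._+ count S′) (≡.trans (count-cong orbit⊆S) (count-orbitUpTo i (suc d) ℕₚ.≤-refl)))
      inv′ : Invariant S′
      inv′ j e with S j in e₁ | orbit i j in e₂ | orbit i (π j) in e₃
      ... | true | false | false rewrite inv j e₁ = ≡.refl
      ... | true | false | true with () ← ≡.trans (≡.sym e₂) (orbit-backward i j e₃)

    period-∣-count : ∀ {S} → Invariant S → suc d ∣ count S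
    period-∣-count {S} inv = <-rec P step (count S) S ≡.refl inv
      where
      P : ℕ → Set
      P m = ∀ S → count S ≡ m → Invariant S → suc d ∣ m
      step : ∀ m → (∀ {m′} → m′ ℕ.< m → P m′) → P m
      step m rec S ≡.refl inv with Finₚ.any? (λ j → S j Boolₚ.≟ true)
      ... | no none = ≡.subst (suc d ∣_) (≡.sym (count-empty S (λ j Sj → none (j , Sj)))) (suc d ∣0)
      ... | yes (i , Si) =
        let (S′ , inv′ , count-S) = remove-orbit inv i Si in
        ≡.subst (suc d ∣_) (≡.sym count-S)
          (∣m∣n⇒∣m+n ∣-refl (rec (≡.subst (count S′ ℕ.<_) (≡.sym count-S) (ℕₚ.m<n+m (count S′) (s≤s z≤n))) S′ ≡.refl inv′))

    period-∣-size : suc d ∣ n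
    period-∣-size = ≡.subst (suc d ∣_) (count-full n) (period-∣-count {λ _ → true} (λ _ _ → ≡.refl))

-- The group ring

module GroupRing {c ℓ g ℓg} (R : Ring c ℓ) (G : Group g ℓg) where
  open Ring R hiding (zero)
  open RingProperties R using (-‿distribˡ-*; -‿distribʳ-*)
  private module G = Group G
  open GroupRingOn Carrier _≈_ _+_ _*_ 0# 1# G.Carrier G._≈_ G._∙_ G.ε public

  ∼-setoid : Setoid _ _
  ∼-setoid = record
    { Carrier = Elem ; _≈_ = _∼_
    ; isEquivalence = record { refl = ∼-refl ; sym = ∼-sym ; trans = ∼-trans } }

  module ∼-Reasoning = SetoidReasoning ∼-setoid

  ≡⇒∼ : ∀ {xs ys} → xs ≡ ys → xs ∼ ys
  ≡⇒∼ ≡.refl = ∼-refl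

  ∷-congʳ : ∀ p {xs ys} → xs ∼ ys → (p ∷ xs) ∼ (p ∷ ys)
  ∷-congʳ p = ∼-cons refl G.refl

  ++-congʳ : ∀ {xs xs′} ys → xs ∼ xs′ → (xs ++ ys) ∼ (xs′ ++ ys)
  ++-congʳ ys ∼-refl = ∼-refl
  ++-congʳ ys (∼-sym p) = ∼-sym (++-congʳ ys p)
  ++-congʳ ys (∼-trans p q) = ∼-trans (++-congʳ ys p) (++-congʳ ys q)
  ++-congʳ ys (∼-cons a b p) = ∼-cons a b (++-congʳ ys p)
  ++-congʳ ys ∼-swap = ∼-swap
  ++-congʳ ys ∼-merge = ∼-merge
  ++-congʳ ys ∼-zero = ∼-zero

  ++-congˡ : ∀ xs {ys ys′} → ys ∼ ys′ → (xs ++ ys) ∼ (xs ++ ys′)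
  ++-congˡ [] p = p
  ++-congˡ (x ∷ xs) p = ∷-congʳ x (++-congˡ xs p)

  ++-cong : ∀ {xs xs′ ys ys′} → xs ∼ xs′ → ys ∼ ys′ → (xs ++ ys) ∼ (xs′ ++ ys′)
  ++-cong {xs′ = xs′} {ys = ys} p q = ∼-trans (++-congʳ ys p) (++-congˡ xs′ q)

  ++-assoc : ∀ xs ys zs → ((xs ++ ys) ++ zs) ∼ (xs ++ (ys ++ zs))
  ++-assoc xs ys zs = ≡⇒∼ (Listₚ.++-assoc xs ys zs)

  ++-∷-move : ∀ xs p ys → (xs ++ p ∷ ys) ∼ (p ∷ (xs ++ ys))
  ++-∷-move [] p ys = ∼-refl
  ++-∷-move (q ∷ xs) p ys = ∼-trans (∷-congʳ q (++-∷-move xs p ys)) ∼-swap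

  ++-comm : ∀ xs ys → (xs ++ ys) ∼ (ys ++ xs)
  ++-comm [] ys = ≡⇒∼ (≡.sym (Listₚ.++-identityʳ ys))
  ++-comm (p ∷ xs) ys = ∼-trans (∷-congʳ p (++-comm xs ys)) (∼-sym (++-∷-move ys p xs))

  ++-interchange : ∀ as bs cs ds → ((as ++ bs) ++ (cs ++ ds)) ∼ ((as ++ cs) ++ (bs ++ ds))
  ++-interchange as bs cs ds = begin
      (as ++ bs) ++ (cs ++ ds) ≈⟨ ++-assoc as bs (cs ++ ds) ⟩
      as ++ (bs ++ (cs ++ ds)) ≈⟨ ++-congˡ as (∼-sym (++-assoc bs cs ds)) ⟩
      as ++ ((bs ++ cs) ++ ds) ≈⟨ ++-congˡ as (++-congʳ ds (++-comm bs cs)) ⟩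
      as ++ ((cs ++ bs) ++ ds) ≈⟨ ++-congˡ as (++-assoc cs bs ds) ⟩
      as ++ (cs ++ (bs ++ ds)) ≈⟨ ∼-sym (++-assoc as cs (bs ++ ds)) ⟩
      (as ++ cs) ++ (bs ++ ds) ∎
    where open ∼-Reasoning

  scale : Carrier → G.Carrier → Elem → Elem
  scale r h ys = ((r , h) ∷ []) · ys

  ·-∷ˡ : ∀ r h xs ys → (((r , h) ∷ xs) · ys) ≡ (scale r h ys ++ (xs · ys))
  ·-∷ˡ r h xs ys = ≡.cong (_++ (xs · ys)) (≡.sym (Listₚ.++-identityʳ _))

  ·-zeroʳ : ∀ xs → (xs · []) ≡ []
  ·-zeroʳ [] = ≡.refl
  ·-zeroʳ ((r , h) ∷ xs) = ·-zeroʳ xs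

  ·-distribʳ-++ : ∀ xs ys zs → ((xs ++ ys) · zs) ≡ ((xs · zs) ++ (ys · zs))
  ·-distribʳ-++ [] ys zs = ≡.refl
  ·-distribʳ-++ ((r , h) ∷ xs) ys zs = begin
      ((r , h) ∷ (xs ++ ys)) · zs                ≡⟨ ·-∷ˡ r h (xs ++ ys) zs ⟩
      scale r h zs ++ ((xs ++ ys) · zs)          ≡⟨ ≡.cong (scale r h zs ++_) (·-distribʳ-++ xs ys zs) ⟩
      scale r h zs ++ ((xs · zs) ++ (ys · zs))   ≡⟨ Listₚ.++-assoc (scale r h zs) _ _ ⟨
      (scale r h zs ++ (xs · zs)) ++ (ys · zs)   ≡⟨ ≡.cong (_++ (ys · zs)) (·-∷ˡ r h xs zs) ⟨
      (((r , h) ∷ xs) · zs) ++ (ys · zs)         ∎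
    where open ≡.≡-Reasoning

  scale-++ : ∀ r h ys zs → scale r h (ys ++ zs) ≡ (scale r h ys ++ scale r h zs)
  scale-++ r h [] zs = ≡.refl
  scale-++ r h ((a , b) ∷ ys) zs = ≡.cong (_ ∷_) (scale-++ r h ys zs)

  scale-congˡ : ∀ {r r′ h h′} ys → r ≈ r′ → h G.≈ h′ → scale r h ys ∼ scale r′ h′ ys
  scale-congˡ [] p q = ∼-refl
  scale-congˡ ((a , b) ∷ ys) p q = ∼-cons (*-congʳ p) (G.∙-congʳ q) (scale-congˡ ys p q)

  scale-congʳ : ∀ r h {ys ys′} → ys ∼ ys′ → scale r h ys ∼ scale r h ys′
  scale-congʳ r h ∼-refl = ∼-refl
  scale-congʳ r h (∼-sym p) = ∼-sym (scale-congʳ r h p)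
  scale-congʳ r h (∼-trans p q) = ∼-trans (scale-congʳ r h p) (scale-congʳ r h q)
  scale-congʳ r h (∼-cons a b p) = ∼-cons (*-congˡ a) (G.∙-congˡ b) (scale-congʳ r h p)
  scale-congʳ r h ∼-swap = ∼-swap
  scale-congʳ r h ∼-merge = ∼-trans ∼-merge (∼-cons (sym (distribˡ r _ _)) G.refl ∼-refl)
  scale-congʳ r h ∼-zero = ∼-trans (∼-cons (zeroʳ r) G.refl ∼-refl) ∼-zero

  scale-distrib-+ : ∀ r r′ h ys → (scale r h ys ++ scale r′ h ys) ∼ scale (r + r′) h ys
  scale-distrib-+ r r′ h [] = ∼-refl
  scale-distrib-+ r r′ h ((a , b) ∷ ys) =
    ∼-trans (∷-congʳ _ (++-∷-move (scale r h ys) _ (scale r′ h ys)))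
      (∼-trans ∼-merge (∼-cons (sym (distribʳ a r r′)) G.refl (scale-distrib-+ r r′ h ys)))

  scale-zero : ∀ h ys → scale 0# h ys ∼ []
  scale-zero h [] = ∼-refl
  scale-zero h ((a , b) ∷ ys) = ∼-trans (∼-cons (zeroˡ a) G.refl (scale-zero h ys)) ∼-zero

  scale-identity : ∀ xs → scale 1# G.ε xs ∼ xs
  scale-identity [] = ∼-refl
  scale-identity ((a , b) ∷ xs) = ∼-cons (*-identityˡ a) (G.identityˡ b) (scale-identity xs)

  ·-congˡ : ∀ xs {ys ys′} → ys ∼ ys′ → (xs · ys) ∼ (xs · ys′)
  ·-congˡ [] p = ∼-refl
  ·-congˡ ((r , h) ∷ xs) {ys} {ys′} p = begin
      ((r , h) ∷ xs) · ys            ≡⟨ ·-∷ˡ r h xs ys ⟩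
      scale r h ys ++ (xs · ys)      ≈⟨ ++-cong (scale-congʳ r h p) (·-congˡ xs p) ⟩
      scale r h ys′ ++ (xs · ys′)    ≡⟨ ·-∷ˡ r h xs ys′ ⟨
      ((r , h) ∷ xs) · ys′           ∎
    where open ∼-Reasoning

  ·-congʳ : ∀ {xs xs′} ys → xs ∼ xs′ → (xs · ys) ∼ (xs′ · ys)
  ·-congʳ ys ∼-refl = ∼-refl
  ·-congʳ ys (∼-sym p) = ∼-sym (·-congʳ ys p)
  ·-congʳ ys (∼-trans p q) = ∼-trans (·-congʳ ys p) (·-congʳ ys q)
  ·-congʳ ys (∼-cons {r} {r′} {h} {h′} {xs} {xs′} a b p) = begin
      ((r , h) ∷ xs) · ys            ≡⟨ ·-∷ˡ r h xs ys ⟩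
      scale r h ys ++ (xs · ys)      ≈⟨ ++-cong (scale-congˡ ys a b) (·-congʳ ys p) ⟩
      scale r′ h′ ys ++ (xs′ · ys)   ≡⟨ ·-∷ˡ r′ h′ xs′ ys ⟨
      ((r′ , h′) ∷ xs′) · ys         ∎
    where open ∼-Reasoning
  ·-congʳ ys (∼-swap {r , h} {r′ , h′} {xs}) = begin
      ((r , h) ∷ (r′ , h′) ∷ xs) · ys                ≡⟨ ·-∷ˡ r h ((r′ , h′) ∷ xs) ys ⟩
      scale r h ys ++ (((r′ , h′) ∷ xs) · ys)        ≡⟨ ≡.cong (scale r h ys ++_) (·-∷ˡ r′ h′ xs ys) ⟩
      scale r h ys ++ (scale r′ h′ ys ++ (xs · ys))  ≈⟨ ++-assoc (scale r h ys) _ _ ⟨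
      (scale r h ys ++ scale r′ h′ ys) ++ (xs · ys)  ≈⟨ ++-congʳ (xs · ys) (++-comm (scale r h ys) _) ⟩
      (scale r′ h′ ys ++ scale r h ys) ++ (xs · ys)  ≈⟨ ++-assoc (scale r′ h′ ys) _ _ ⟩
      scale r′ h′ ys ++ (scale r h ys ++ (xs · ys))  ≡⟨ ≡.cong (scale r′ h′ ys ++_) (·-∷ˡ r h xs ys) ⟨
      scale r′ h′ ys ++ (((r , h) ∷ xs) · ys)        ≡⟨ ·-∷ˡ r′ h′ ((r , h) ∷ xs) ys ⟨
      ((r′ , h′) ∷ (r , h) ∷ xs) · ys                ∎
    where open ∼-Reasoning
  ·-congʳ ys (∼-merge {r} {r′} {h} {xs}) = begin
      ((r , h) ∷ (r′ , h) ∷ xs) · ys                ≡⟨ ·-∷ˡ r h ((r′ , h) ∷ xs) ys ⟩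
      scale r h ys ++ (((r′ , h) ∷ xs) · ys)        ≡⟨ ≡.cong (scale r h ys ++_) (·-∷ˡ r′ h xs ys) ⟩
      scale r h ys ++ (scale r′ h ys ++ (xs · ys))  ≈⟨ ++-assoc (scale r h ys) _ _ ⟨
      (scale r h ys ++ scale r′ h ys) ++ (xs · ys)  ≈⟨ ++-congʳ (xs · ys) (scale-distrib-+ r r′ h ys) ⟩
      scale (r + r′) h ys ++ (xs · ys)              ≡⟨ ·-∷ˡ (r + r′) h xs ys ⟨
      ((r + r′ , h) ∷ xs) · ys                      ∎
    where open ∼-Reasoning
  ·-congʳ ys (∼-zero {h} {xs}) = ∼-trans (≡⇒∼ (·-∷ˡ 0# h xs ys)) (++-congʳ (xs · ys) (scale-zero h ys))

  ·-cong : ∀ {xs xs′ ys ys′} → xs ∼ xs′ → ys ∼ ys′ → (xs · ys) ∼ (xs′ · ys′)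
  ·-cong {xs′ = xs′} {ys = ys} p q = ∼-trans (·-congʳ ys p) (·-congˡ xs′ q)

  ·-distribˡ-++ : ∀ xs ys zs → (xs · (ys ++ zs)) ∼ ((xs · ys) ++ (xs · zs))
  ·-distribˡ-++ [] ys zs = ∼-refl
  ·-distribˡ-++ ((r , h) ∷ xs) ys zs = begin
      ((r , h) ∷ xs) · (ys ++ zs)
        ≡⟨ ·-∷ˡ r h xs _ ⟩
      scale r h (ys ++ zs) ++ (xs · (ys ++ zs))
        ≡⟨ ≡.cong (_++ _) (scale-++ r h ys zs) ⟩
      (scale r h ys ++ scale r h zs) ++ (xs · (ys ++ zs))
        ≈⟨ ++-congˡ (scale r h ys ++ scale r h zs) (·-distribˡ-++ xs ys zs) ⟩
      (scale r h ys ++ scale r h zs) ++ ((xs · ys) ++ (xs · zs))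
        ≈⟨ ++-interchange (scale r h ys) _ _ _ ⟩
      (scale r h ys ++ (xs · ys)) ++ (scale r h zs ++ (xs · zs))
        ≡⟨ ≡.cong₂ _++_ (·-∷ˡ r h xs ys) (·-∷ˡ r h xs zs) ⟨
      (((r , h) ∷ xs) · ys) ++ (((r , h) ∷ xs) · zs) ∎
    where open ∼-Reasoning

  scale-scale : ∀ r h a b zs → scale (r * a) (h G.∙ b) zs ∼ scale r h (scale a b zs)
  scale-scale r h a b [] = ∼-refl
  scale-scale r h a b ((x , y) ∷ zs) = ∼-cons (*-assoc r a x) (G.assoc h b y) (scale-scale r h a b zs)

  scale-· : ∀ r h ys zs → (scale r h ys · zs) ∼ scale r h (ys · zs)
  scale-· r h [] zs = ∼-refl
  scale-· r h ((a , b) ∷ ys) zs = begin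
      ((r * a , h G.∙ b) ∷ scale r h ys) · zs            ≡⟨ ·-∷ˡ _ _ (scale r h ys) zs ⟩
      scale (r * a) (h G.∙ b) zs ++ (scale r h ys · zs)  ≈⟨ ++-cong (scale-scale r h a b zs) (scale-· r h ys zs) ⟩
      scale r h (scale a b zs) ++ scale r h (ys · zs)    ≡⟨ scale-++ r h (scale a b zs) _ ⟨
      scale r h (scale a b zs ++ (ys · zs))              ≡⟨ ≡.cong (scale r h) (·-∷ˡ a b ys zs) ⟨
      scale r h (((a , b) ∷ ys) · zs)                    ∎
    where open ∼-Reasoning

  ·-assoc : ∀ xs ys zs → ((xs · ys) · zs) ∼ (xs · (ys · zs))
  ·-assoc [] ys zs = ∼-refl
  ·-assoc ((r , h) ∷ xs) ys zs = begin
      (((r , h) ∷ xs) · ys) · zs             ≡⟨ ≡.cong (_· zs) (·-∷ˡ r h xs ys) ⟩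
      (scale r h ys ++ (xs · ys)) · zs       ≡⟨ ·-distribʳ-++ (scale r h ys) _ zs ⟩
      (scale r h ys · zs) ++ ((xs · ys) · zs) ≈⟨ ++-cong (scale-· r h ys zs) (·-assoc xs ys zs) ⟩
      scale r h (ys · zs) ++ (xs · (ys · zs)) ≡⟨ ·-∷ˡ r h xs _ ⟨
      ((r , h) ∷ xs) · (ys · zs)             ∎
    where open ∼-Reasoning

  ·-identityˡ : ∀ xs → (one · xs) ∼ xs
  ·-identityˡ = scale-identity

  ·-identityʳ : ∀ xs → (xs · one) ∼ xs
  ·-identityʳ [] = ∼-refl
  ·-identityʳ ((r , h) ∷ xs) = ∼-cons (*-identityʳ r) (G.identityʳ h) (·-identityʳ xs)

  neg : Elem → Elem
  neg [] = []
  neg ((r , h) ∷ xs) = (- r , h) ∷ neg xs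

  ++-inverseʳ : ∀ xs → (xs ++ neg xs) ∼ []
  ++-inverseʳ [] = ∼-refl
  ++-inverseʳ ((r , h) ∷ xs) =
    ∼-trans (∷-congʳ _ (++-∷-move xs (- r , h) (neg xs)))
      (∼-trans ∼-merge (∼-trans (∼-cons (-‿inverseʳ r) G.refl (++-inverseʳ xs)) ∼-zero))

  ++-cancelˡ : ∀ xs {ys zs} → (xs ++ ys) ∼ (xs ++ zs) → ys ∼ zs
  ++-cancelˡ xs {ys} {zs} e = begin
      ys                      ≈⟨ ++-congʳ ys inverseˡ ⟨
      (neg xs ++ xs) ++ ys    ≈⟨ ++-assoc (neg xs) xs ys ⟩
      neg xs ++ (xs ++ ys)    ≈⟨ ++-congˡ (neg xs) e ⟩
      neg xs ++ (xs ++ zs)    ≈⟨ ++-assoc (neg xs) xs zs ⟨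
      (neg xs ++ xs) ++ zs    ≈⟨ ++-congʳ zs inverseˡ ⟩
      zs                      ∎
    where
    open ∼-Reasoning
    inverseˡ : (neg xs ++ xs) ∼ []
    inverseˡ = ∼-trans (++-comm (neg xs) xs) (++-inverseʳ xs)

  neg-++ : ∀ xs ys → neg (xs ++ ys) ≡ (neg xs ++ neg ys)
  neg-++ [] ys = ≡.refl
  neg-++ ((r , h) ∷ xs) ys = ≡.cong (_ ∷_) (neg-++ xs ys)

  scale-neg : ∀ r h ys → scale r h (neg ys) ∼ neg (scale r h ys)
  scale-neg r h [] = ∼-refl
  scale-neg r h ((a , b) ∷ ys) = ∼-cons (sym (-‿distribʳ-* r a)) G.refl (scale-neg r h ys)

  scale-neg-coeff : ∀ r h ys → scale (- r) h ys ∼ neg (scale r h ys)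
  scale-neg-coeff r h [] = ∼-refl
  scale-neg-coeff r h ((a , b) ∷ ys) = ∼-cons (sym (-‿distribˡ-* r a)) G.refl (scale-neg-coeff r h ys)

  neg-∷-· : ∀ r h xs ys → neg (((r , h) ∷ xs) · ys) ≡ (neg (scale r h ys) ++ neg (xs · ys))
  neg-∷-· r h xs ys = ≡.trans (≡.cong neg (·-∷ˡ r h xs ys)) (neg-++ (scale r h ys) (xs · ys))

  ·-negʳ : ∀ xs ys → (xs · neg ys) ∼ neg (xs · ys)
  ·-negʳ [] ys = ∼-refl
  ·-negʳ ((r , h) ∷ xs) ys =
    ∼-trans (≡⇒∼ (·-∷ˡ r h xs (neg ys)))
      (∼-trans (++-cong (scale-neg r h ys) (·-negʳ xs ys)) (≡⇒∼ (≡.sym (neg-∷-· r h xs ys))))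

  ·-negˡ : ∀ xs ys → (neg xs · ys) ∼ neg (xs · ys)
  ·-negˡ [] ys = ∼-refl
  ·-negˡ ((r , h) ∷ xs) ys =
    ∼-trans (≡⇒∼ (·-∷ˡ (- r) h (neg xs) ys))
      (∼-trans (++-cong (scale-neg-coeff r h ys) (·-negˡ xs ys)) (≡⇒∼ (≡.sym (neg-∷-· r h xs ys))))

  ^-cong : ∀ {x y} n → x ∼ y → (x ^ n) ∼ (y ^ n)
  ^-cong zero p = ∼-refl
  ^-cong (suc n) p = ·-cong p (^-cong n p)

  ^-distribˡ-+-· : ∀ x m n → (x ^ (m ℕ.+ n)) ∼ ((x ^ m) · (x ^ n))
  ^-distribˡ-+-· x zero n = ∼-sym (·-identityˡ (x ^ n))
  ^-distribˡ-+-· x (suc m) n =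
    ∼-trans (·-congˡ x (^-distribˡ-+-· x m n)) (∼-sym (·-assoc x (x ^ m) (x ^ n)))

  ^-*-assoc : ∀ x m n → ((x ^ n) ^ m) ∼ (x ^ (m ℕ.* n))
  ^-*-assoc x zero n = ∼-refl
  ^-*-assoc x (suc m) n = ∼-sym (∼-trans (^-distribˡ-+-· x n (m ℕ.* n)) (·-congˡ (x ^ n) (∼-sym (^-*-assoc x m n))))

  ^-*-comm : ∀ x m n → (x ^ (m ℕ.* n)) ∼ ((x ^ m) ^ n)
  ^-*-comm x m n = ∼-trans (≡⇒∼ (≡.cong (x ^_) (ℕₚ.*-comm m n))) (∼-sym (^-*-assoc x n m))

  one-^ : ∀ n → (one ^ n) ∼ one
  one-^ zero = ∼-refl
  one-^ (suc n) = ∼-trans (·-congˡ one (one-^ n)) (·-identityˡ one)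

  IsUnit-resp : ∀ {x x′} → x ∼ x′ → IsUnit x → IsUnit x′
  IsUnit-resp p (y , xy , yx) = y , ∼-trans (·-congʳ y (∼-sym p)) xy , ∼-trans (·-congˡ y (∼-sym p)) yx

  IsUnit-one : IsUnit one
  IsUnit-one = one , ·-identityˡ one , ·-identityˡ one

  IsUnit-· : ∀ {x y} → IsUnit x → IsUnit y → IsUnit (x · y)
  IsUnit-· {x} {y} (u , xu , ux) (v , yv , vy) = v · u , inverse x y u v xu yv , inverse v u y x vy ux
    where
    inverse : ∀ x y u v → (x · u) ∼ one → (y · v) ∼ one → ((x · y) · (v · u)) ∼ one
    inverse x y u v p q = begin
        (x · y) · (v · u) ≈⟨ ·-assoc x y _ ⟩
        x · (y · (v · u)) ≈⟨ ·-congˡ x (∼-sym (·-assoc y v u)) ⟩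
        x · ((y · v) · u) ≈⟨ ·-congˡ x (·-congʳ u q) ⟩
        x · (one · u)     ≈⟨ ·-congˡ x (·-identityˡ u) ⟩
        x · u             ≈⟨ p ⟩
        one               ∎
      where open ∼-Reasoning

  ·-cancelʳ : ∀ {z} → IsUnit z → ∀ {a b} → (a · z) ∼ (b · z) → a ∼ b
  ·-cancelʳ {z} (u , zu , uz) {a} {b} p = begin
      a             ≈⟨ ∼-sym (·-identityʳ a) ⟩
      a · one       ≈⟨ ·-congˡ a (∼-sym zu) ⟩
      a · (z · u)   ≈⟨ ∼-sym (·-assoc a z u) ⟩
      (a · z) · u   ≈⟨ ·-congʳ u p ⟩
      (b · z) · u   ≈⟨ ·-assoc b z u ⟩
      b · (z · u)   ≈⟨ ·-congˡ b zu ⟩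
      b · one       ≈⟨ ·-identityʳ b ⟩
      b             ∎
    where open ∼-Reasoning

  ·-cancelˡ : ∀ {z} → IsUnit z → ∀ {a b} → (z · a) ∼ (z · b) → a ∼ b
  ·-cancelˡ {z} (u , zu , uz) {a} {b} p = begin
      a             ≈⟨ ∼-sym (·-identityˡ a) ⟩
      one · a       ≈⟨ ·-congʳ a (∼-sym uz) ⟩
      (u · z) · a   ≈⟨ ·-assoc u z a ⟩
      u · (z · a)   ≈⟨ ·-congˡ u p ⟩
      u · (z · b)   ≈⟨ ∼-sym (·-assoc u z b) ⟩
      (u · z) · b   ≈⟨ ·-congʳ b uz ⟩
      one · b       ≈⟨ ·-identityˡ b ⟩
      b             ∎
    where open ∼-Reasoning

  CoeffsIn : ∀ {q} → Pred Carrier q → Pred Elem (c ⊔ g ⊔ q)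
  CoeffsIn P = All.All (λ t → P (proj₁ t))

  CoeffsIn-scale : ∀ {q₁ q₂} {P : Pred Carrier q₁} {Q : Pred Carrier q₂} r h ys →
                   (∀ {y} → Q y → P (r * y)) → CoeffsIn Q ys → CoeffsIn P (scale r h ys)
  CoeffsIn-scale r h [] rQ All.[] = All.[]
  CoeffsIn-scale r h ((a , b) ∷ ys) rQ (qa All.∷ qys) = rQ qa All.∷ CoeffsIn-scale r h ys rQ qys

  CoeffsIn-· : ∀ {q₁ q₂ q₃} {P : Pred Carrier q₁} {Q : Pred Carrier q₂} {S : Pred Carrier q₃} →
               (∀ {x y} → P x → Q y → S (x * y)) →
               ∀ xs ys → CoeffsIn P xs → CoeffsIn Q ys → CoeffsIn S (xs · ys)
  CoeffsIn-· PQ⇒S [] ys All.[] qys = All.[]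
  CoeffsIn-· PQ⇒S ((r , h) ∷ xs) ys (pr All.∷ pxs) qys =
    ≡.subst (CoeffsIn _) (≡.sym (·-∷ˡ r h xs ys))
      (Allₚ.++⁺ (CoeffsIn-scale r h ys (PQ⇒S pr) qys) (CoeffsIn-· PQ⇒S xs ys pxs qys))

  CoeffsIn-≈0⇒∼[] : ∀ {xs} → CoeffsIn (_≈ 0#) xs → xs ∼ []
  CoeffsIn-≈0⇒∼[] All.[] = ∼-refl
  CoeffsIn-≈0⇒∼[] (px All.∷ pxs) = ∼-trans (∼-cons px G.refl (CoeffsIn-≈0⇒∼[] pxs)) ∼-zero

  OnePlus : ∀ {q} → Pred Carrier q → Pred Elem (c ⊔ ℓ ⊔ g ⊔ ℓg ⊔ q)
  OnePlus P x = Σ Elem λ y → CoeffsIn P y × x ∼ (one ++ y)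

  OnePlus-resp : ∀ {q} {P : Pred Carrier q} {x x′} → x ∼ x′ → OnePlus P x → OnePlus P x′
  OnePlus-resp x∼x′ (y , Py , x∼1+y) = y , Py , ∼-trans (∼-sym x∼x′) x∼1+y

  one++-·-one++ : ∀ a b → ((one ++ a) · (one ++ b)) ∼ (one ++ (b ++ (a ++ (a · b))))
  one++-·-one++ a b = begin
      (one ++ a) · (one ++ b)                   ≡⟨ ·-distribʳ-++ one a (one ++ b) ⟩
      (one · (one ++ b)) ++ (a · (one ++ b))    ≈⟨ ++-cong (·-identityˡ (one ++ b)) (·-distribˡ-++ a one b) ⟩
      (one ++ b) ++ ((a · one) ++ (a · b))      ≈⟨ ++-congˡ (one ++ b) (++-congʳ (a · b) (·-identityʳ a)) ⟩
      one ++ (b ++ (a ++ (a · b)))              ∎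
    where open ∼-Reasoning

  OnePlus-· : ∀ {q} {P : Pred Carrier q} → (∀ {a b} → P a → P b → P (a * b)) →
              ∀ {x y} → OnePlus P x → OnePlus P y → OnePlus P (x · y)
  OnePlus-· P-* (a , Pa , x∼1+a) (b , Pb , y∼1+b) =
    b ++ (a ++ (a · b)) , Allₚ.++⁺ Pb (Allₚ.++⁺ Pa (CoeffsIn-· P-* a b Pa Pb)) ,
    ∼-trans (·-cong x∼1+a y∼1+b) (one++-·-one++ a b)

  one++-^ : ∀ {q₁ q₂} {P : Pred Carrier q₁} {Q : Pred Carrier q₂} →
            (∀ {a b} → P a → P b → Q (a * b)) → (∀ {a b} → P a → Q b → Q (a * b)) →
            ∀ {y} → CoeffsIn P y → ∀ n →
            Σ Elem λ t → CoeffsIn Q t × ((one ++ y) ^ n) ∼ (one ++ (concat (replicate n y) ++ t))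
  one++-^ PP⇒Q PQ⇒Q Py zero = [] , All.[] , ∼-refl
  one++-^ PP⇒Q PQ⇒Q {y} Py (suc n) with one++-^ PP⇒Q PQ⇒Q Py n
  ... | t , Qt , [1+y]ⁿ∼1+ny+t = t ++ ((y · ny) ++ (y · t)) , Qt′ , (begin
      (one ++ y) · ((one ++ y) ^ n)
        ≈⟨ ·-congˡ (one ++ y) [1+y]ⁿ∼1+ny+t ⟩
      (one ++ y) · (one ++ (ny ++ t))
        ≈⟨ one++-·-one++ y (ny ++ t) ⟩
      one ++ ((ny ++ t) ++ (y ++ (y · (ny ++ t))))
        ≈⟨ ++-congˡ one (++-congˡ (ny ++ t) (++-congˡ y (·-distribˡ-++ y ny t))) ⟩
      one ++ ((ny ++ t) ++ (y ++ ((y · ny) ++ (y · t))))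
        ≈⟨ ++-congˡ one (++-interchange ny t y _) ⟩
      one ++ ((ny ++ y) ++ (t ++ ((y · ny) ++ (y · t))))
        ≈⟨ ++-congˡ one (++-congʳ _ (++-comm ny y)) ⟩
      one ++ ((y ++ ny) ++ (t ++ ((y · ny) ++ (y · t)))) ∎)
    where
    open ∼-Reasoning
    ny = concat (replicate n y)
    Pny : CoeffsIn _ ny
    Pny = Allₚ.concat⁺ (Allₚ.replicate⁺ n Py)
    Qt′ = Allₚ.++⁺ Qt (Allₚ.++⁺ (CoeffsIn-· PP⇒Q y ny Py Pny) (CoeffsIn-· PQ⇒Q y t Py Qt))

  module _ (t : Elem) where
    private
      u = one ++ t
      a = neg t

    one++-·-neg : (u · a) ∼ (a · u)
    one++-·-neg = begin
        u · a                    ≡⟨ ·-distribʳ-++ one t a ⟩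
        (one · a) ++ (t · a)     ≈⟨ ++-cong (·-identityˡ a) (·-negʳ t t) ⟩
        a ++ neg (t · t)         ≈⟨ ++-congˡ a (·-negˡ t t) ⟨
        a ++ (a · t)             ≈⟨ ++-congʳ (a · t) (·-identityʳ a) ⟨
        (a · one) ++ (a · t)     ≈⟨ ·-distribˡ-++ a one t ⟨
        a · u                    ∎
      where open ∼-Reasoning

    geometric : ℕ → Elem
    geometric zero = []
    geometric (suc j) = one ++ (a · geometric j)

    ·-geometric : ∀ j → (u · (a · geometric j)) ∼ (a · (u · geometric j))
    ·-geometric j = ∼-trans (∼-sym (·-assoc u a (geometric j)))
                      (∼-trans (·-congʳ (geometric j) one++-·-neg) (·-assoc a u (geometric j)))

    one++-·-geometric : ∀ j → ((u · geometric j) ++ (a ^ j)) ∼ one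
    one++-·-geometric zero = ≡⇒∼ (≡.cong (_++ one) (·-zeroʳ u))
    one++-·-geometric (suc j) = begin
        (u · (one ++ (a · geometric j))) ++ (a · (a ^ j))
          ≈⟨ ++-congʳ (a · (a ^ j)) (·-distribˡ-++ u one (a · geometric j)) ⟩
        ((u · one) ++ (u · (a · geometric j))) ++ (a · (a ^ j))
          ≈⟨ ++-congʳ (a · (a ^ j)) (++-cong (·-identityʳ u) (·-geometric j)) ⟩
        (u ++ (a · (u · geometric j))) ++ (a · (a ^ j))
          ≈⟨ ++-assoc u _ _ ⟩
        u ++ ((a · (u · geometric j)) ++ (a · (a ^ j)))
          ≈⟨ ++-congˡ u (·-distribˡ-++ a (u · geometric j) (a ^ j)) ⟨
        u ++ (a · ((u · geometric j) ++ (a ^ j)))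
          ≈⟨ ++-congˡ u (·-congˡ a (one++-·-geometric j)) ⟩
        u ++ (a · one)
          ≈⟨ ++-congˡ u (·-identityʳ a) ⟩
        one ++ (t ++ a)
          ≈⟨ ++-congˡ one (++-inverseʳ t) ⟩
        one ∎
      where open ∼-Reasoning

    one++-geometric-comm : ∀ j → (u · geometric j) ∼ (geometric j · u)
    one++-geometric-comm zero = ≡⇒∼ (·-zeroʳ u)
    one++-geometric-comm (suc j) = begin
        u · (one ++ (a · geometric j))           ≈⟨ ·-distribˡ-++ u one (a · geometric j) ⟩
        (u · one) ++ (u · (a · geometric j))     ≈⟨ ++-cong (·-identityʳ u) (·-geometric j) ⟩
        u ++ (a · (u · geometric j))             ≈⟨ ++-congˡ u (·-congˡ a (one++-geometric-comm j)) ⟩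
        u ++ (a · (geometric j · u))             ≈⟨ ++-cong (·-identityˡ u) (·-assoc a (geometric j) u) ⟨
        (one · u) ++ ((a · geometric j) · u)     ≡⟨ ·-distribʳ-++ one (a · geometric j) u ⟨
        (one ++ (a · geometric j)) · u           ∎
      where open ∼-Reasoning

    -- inverted by the geometric series in -t, which terminates
    one++-IsUnit : ∀ k → ((neg t) ^ k) ∼ [] → IsUnit (one ++ t)
    one++-IsUnit k aᵏ∼0 = geometric k , inverseʳ , ∼-trans (∼-sym (one++-geometric-comm k)) inverseʳ
      where
      inverseʳ : (u · geometric k) ∼ one
      inverseʳ = ∼-trans (≡⇒∼ (≡.sym (Listₚ.++-identityʳ _)))
                   (∼-trans (++-congˡ (u · geometric k) (∼-sym aᵏ∼0)) (one++-·-geometric k))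

-- Lagrange's theorem

IsLeastPositive : ∀ {p} → (ℕ → Set p) → ℕ → Set p
IsLeastPositive P d = 0 ℕ.< d × P d × (∀ t → 0 ℕ.< t → t ℕ.< d → ¬ P t)

least-positive-≤ : ∀ {p} {P : ℕ → Set p} → (∀ t → Dec (P t)) →
                   ∀ b → (Σ ℕ (IsLeastPositive P)) ⊎ (∀ t → 0 ℕ.< t → t ℕ.≤ b → ¬ P t)
least-positive-≤ P? zero = inj₂ λ t 0<t t≤0 _ → ℕₚ.<-irrefl ≡.refl (ℕₚ.<-≤-trans 0<t t≤0)
least-positive-≤ P? (suc b) with least-positive-≤ P? b
... | inj₁ least = inj₁ least
... | inj₂ none with P? (suc b)
...   | yes Pb = inj₁ (suc b , s≤s z≤n , Pb , λ t 0<t t<1+b → none t 0<t (ℕₚ.≤-pred t<1+b))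
...   | no ¬Pb = inj₂ λ t 0<t t≤1+b →
  [ (λ t<1+b → none t 0<t (ℕₚ.≤-pred t<1+b)) , (λ { ≡.refl → ¬Pb }) ]′ (ℕₚ.m≤n⇒m<n∨m≡n t≤1+b)

least-positive : ∀ {p} {P : ℕ → Set p} → (∀ t → Dec (P t)) → ∀ {e} → 0 ℕ.< e → P e → Σ ℕ (IsLeastPositive P)
least-positive P? {e} 0<e Pe with least-positive-≤ P? e
... | inj₁ least = least
... | inj₂ none = ⊥-elim (none e 0<e ℕₚ.≤-refl Pe)

module FiniteSubmonoid {c ℓ g ℓg} (R : Ring c ℓ) (G : Group g ℓg) where
  open GroupRing R G

  -- The orbits of left multiplication by y on U all have the size of the order of y.
  module _ {u} (U : Pred Elem u) (U-resp : ∀ {x x′} → x ∼ x′ → U x → U x′)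
           (U⇒IsUnit : ∀ {x} → U x → IsUnit x) (U-one : U one) (U-· : ∀ {x y} → U x → U y → U (x · y))
           {n} (card : HasCard _∼_ U n) where

    private
      enum = proj₁ card
      enum-∈ = proj₁ (proj₂ card)
      enum-injective = proj₁ (proj₂ (proj₂ card))

      index : ∀ {x} → U x → Fin n
      index {x} Ux = proj₁ (proj₂ (proj₂ (proj₂ card)) x Ux)

      enum-index : ∀ {x} (Ux : U x) → enum (index Ux) ∼ x
      enum-index {x} Ux = proj₂ (proj₂ (proj₂ (proj₂ card)) x Ux)

      index-injective : ∀ {x y} (Ux : U x) (Uy : U y) → index Ux ≡ index Uy → x ∼ y
      index-injective Ux Uy e = ∼-trans (∼-sym (enum-index Ux)) (∼-trans (≡⇒∼ (≡.cong enum e)) (enum-index Uy))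

    module _ {y} (Uy : U y) where

      U-^ : ∀ t → U (y ^ t)
      U-^ zero = U-one
      U-^ (suc t) = U-· Uy (U-^ t)

      ^≟one : ∀ t → Dec ((y ^ t) ∼ one)
      ^≟one t with index (U-^ t) Finₚ.≟ index U-one
      ... | yes e = yes (index-injective (U-^ t) U-one e)
      ... | no ne = no λ yᵗ≈1 → ne (enum-injective _ _
              (∼-trans (enum-index (U-^ t)) (∼-trans yᵗ≈1 (∼-sym (enum-index U-one)))))

      ^-cancel : ∀ {a b} z → U z → a ℕ.< b → ((y ^ b) · z) ∼ ((y ^ a) · z) → (y ^ (b ∸ a)) ∼ one
      ^-cancel {a} {b} z Uz a<b yᵇz≈yᵃz = ·-cancelʳ (U⇒IsUnit (U-· (U-^ a) Uz)) (begin
          (y ^ (b ∸ a)) · ((y ^ a) · z)   ≈⟨ ·-assoc (y ^ (b ∸ a)) (y ^ a) z ⟨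
          ((y ^ (b ∸ a)) · (y ^ a)) · z   ≈⟨ ·-congʳ z (^-distribˡ-+-· y (b ∸ a) a) ⟨
          (y ^ ((b ∸ a) ℕ.+ a)) · z       ≡⟨ ≡.cong (λ m → (y ^ m) · z) (ℕₚ.m∸n+n≡m (ℕₚ.<⇒≤ a<b)) ⟩
          (y ^ b) · z                     ≈⟨ yᵇz≈yᵃz ⟩
          (y ^ a) · z                     ≈⟨ ·-identityˡ _ ⟨
          one · ((y ^ a) · z)             ∎)
        where open ∼-Reasoning

      -- pigeonhole on y⁰, …, yⁿ
      order : Σ ℕ (IsLeastPositive (λ t → (y ^ t) ∼ one))
      order with Finₚ.pigeonhole (ℕₚ.n<1+n n) (λ t → index (U-^ (toℕ t)))
      ... | i , j , i<j , e = least-positive ^≟one (ℕₚ.m<n⇒0<n∸m i<j) (^-cancel one U-one i<j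
            (∼-trans (·-identityʳ _)
              (∼-trans (∼-sym (index-injective (U-^ (toℕ i)) (U-^ (toℕ j)) e)) (∼-sym (·-identityʳ _)))))

      π : Fin n → Fin n
      π i = index (U-· Uy (enum-∈ i))

      enum-π : ∀ i → enum (π i) ∼ (y · enum i)
      enum-π i = enum-index (U-· Uy (enum-∈ i))

      π-injective : ∀ {i j} → π i ≡ π j → i ≡ j
      π-injective {i} {j} e = enum-injective i j (·-cancelˡ (U⇒IsUnit Uy)
        (∼-trans (∼-sym (enum-π i)) (∼-trans (≡⇒∼ (≡.cong enum e)) (enum-π j))))

      open Orbits π π-injective

      enum-iterate : ∀ t i → enum (iterate t i) ∼ ((y ^ t) · enum i)
      enum-iterate zero i = ∼-sym (·-identityˡ (enum i))
      enum-iterate (suc t) i =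
        ∼-trans (enum-π (iterate t i)) (∼-trans (·-congˡ y (enum-iterate t i)) (∼-sym (·-assoc y (y ^ t) (enum i))))

      iterate-period : ∀ {d} → (y ^ d) ∼ one → ∀ i → iterate d i ≡ i
      iterate-period {d} yᵈ≈1 i =
        enum-injective _ _ (∼-trans (enum-iterate d i) (∼-trans (·-congʳ (enum i) yᵈ≈1) (·-identityˡ (enum i))))

      iterate-distinct : ∀ {d} → IsLeastPositive (λ t → (y ^ t) ∼ one) d →
                         ∀ i t u → t ℕ.< u → u ℕ.< d → iterate t i ≢ iterate u i
      iterate-distinct (_ , _ , minimal) i t u t<u u<d e =
        minimal (u ∸ t) (ℕₚ.m<n⇒0<n∸m t<u) (ℕₚ.≤-<-trans (ℕₚ.m∸n≤m u t) u<d) (^-cancel (enum i) (enum-∈ i) t<u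
          (∼-trans (∼-sym (enum-iterate u i)) (∼-trans (≡⇒∼ (≡.cong enum (≡.sym e))) (enum-iterate t i))))

      ^-size≈one : (y ^ n) ∼ one
      ^-size≈one with order
      ... | suc d , least@(_ , yᵈ⁺¹≈1 , _)
          with Period.period-∣-size d (iterate-period {suc d} yᵈ⁺¹≈1) (iterate-distinct least)
      ...   | divides q n≡q*[d+1] = begin
          y ^ n                ≡⟨ ≡.cong (y ^_) n≡q*[d+1] ⟩
          y ^ (q ℕ.* suc d)    ≈⟨ ^-*-assoc y q (suc d) ⟨
          (y ^ suc d) ^ q      ≈⟨ ^-cong q yᵈ⁺¹≈1 ⟩
          one ^ q              ≈⟨ one-^ q ⟩
          one                  ∎
        where open ∼-Reasoning

-- Coefficients with respect to a finite group

funToFin-cong : ∀ {m n} {f g : Fin m → Fin n} → (∀ i → f i ≡ g i) → funToFin f ≡ funToFin g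
funToFin-cong {zero} f≗g = ≡.refl
funToFin-cong {suc m} f≗g = ≡.cong₂ Fin.combine (f≗g Fin.zero) (funToFin-cong (λ i → f≗g (Fin.suc i)))

finToFun-injective : ∀ {m n} (i j : Fin (m ℕ.^ n)) → (∀ k → finToFun {m} {n} i k ≡ finToFun j k) → i ≡ j
finToFun-injective {m} {n} i j e =
  ≡.trans (≡.sym (Finₚ.funToFin-finToFin {n} {m} i)) (≡.trans (funToFin-cong e) (Finₚ.funToFin-finToFin {n} {m} j))

updateAt-preserves : ∀ {a q n} {A : Set a} {P : Pred A q} (xs : Fin n → A) j {f : A → A} →
                     (∀ i → P (xs i)) → (∀ {x} → P x → P (f x)) → ∀ i → P (updateAt xs j f i)
updateAt-preserves {P = P} xs j Pxs Pf i with i Finₚ.≟ j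
... | yes ≡.refl = ≡.subst P (≡.sym (Vecₚ.updateAt-updates i xs)) (Pf (Pxs i))
... | no i≢j = ≡.subst P (≡.sym (Vecₚ.updateAt-minimal i j xs i≢j)) (Pxs i)

module FiniteBasis {c ℓ g ℓg} (R : Ring c ℓ) (G : Group g ℓg) {h} (basis : Fin h → Group.Carrier G)
                   (basis-injective : ∀ i j → Group._≈_ G (basis i) (basis j) → i ≡ j)
                   (basis-surjective : ∀ a → Σ (Fin h) λ i → Group._≈_ G (basis i) a) where
  open Ring R
  open GroupRing R G
  open CommSemigroupProperties +-commutativeSemigroup using (x∙yz≈y∙xz)
  private module G = Group G

  combination : (Fin h → Carrier) → Elem
  combination cs = tabulate (λ i → cs i , basis i)

  CoeffsIn-combination : ∀ {q} {P : Pred Carrier q} {cs} → (∀ i → P (cs i)) → CoeffsIn P (combination cs)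
  CoeffsIn-combination = Allₚ.tabulate⁺

  combination-cong : ∀ {h′} {cs cs′ : Fin h′ → Carrier} {bs : Fin h′ → G.Carrier} → (∀ i → cs i ≈ cs′ i) →
                     tabulate (λ i → cs i , bs i) ∼ tabulate (λ i → cs′ i , bs i)
  combination-cong {zero} cs≈cs′ = ∼-refl
  combination-cong {suc h′} cs≈cs′ = ∼-cons (cs≈cs′ Fin.zero) G.refl (combination-cong (λ i → cs≈cs′ (Fin.suc i)))

  ∷-combination : ∀ {h′} (cs : Fin h′ → Carrier) (bs : Fin h′ → G.Carrier) j r →
                  ((r , bs j) ∷ tabulate (λ i → cs i , bs i)) ∼ tabulate (λ i → updateAt cs j (r +_) i , bs i)
  ∷-combination {suc h′} cs bs Fin.zero r = ∼-merge
  ∷-combination {suc h′} cs bs (Fin.suc j) r =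
    ∼-trans ∼-swap (∷-congʳ _ (∷-combination (λ i → cs (Fin.suc i)) (λ i → bs (Fin.suc i)) j r))

  combination-complete : ∀ {q} (P : Pred Carrier q) → P 0# → (∀ {x y} → P x → P y → P (x + y)) →
                         ∀ {xs} → CoeffsIn P xs → Σ (Fin h → Carrier) λ cs → (∀ i → P (cs i)) × combination cs ∼ xs
  combination-complete P P0 P+ All.[] = (λ _ → 0#) , (λ _ → P0) , CoeffsIn-≈0⇒∼[] (CoeffsIn-combination (λ _ → refl))
  combination-complete P P0 P+ {(r , a) ∷ xs} (Pr All.∷ Pxs) with combination-complete P P0 P+ Pxs
  ... | cs , Pcs , cs∼xs =
    updateAt cs j (r +_) , updateAt-preserves {P = P} cs j Pcs (P+ Pr) ,
    ∼-trans (∼-sym (∷-combination cs basis j r)) (∼-cons refl (proj₂ (basis-surjective a)) cs∼xs)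
    where j = proj₁ (basis-surjective a)

  _≟G_ : ∀ a b → Dec (a G.≈ b)
  a ≟G b with proj₁ (basis-surjective a) Finₚ.≟ proj₁ (basis-surjective b)
  ... | yes e = yes (G.trans (G.sym (proj₂ (basis-surjective a)))
                      (G.trans (G.reflexive (≡.cong basis e)) (proj₂ (basis-surjective b))))
  ... | no ne = no λ a≈b → ne (basis-injective _ _
                  (G.trans (proj₂ (basis-surjective a)) (G.trans a≈b (G.sym (proj₂ (basis-surjective b))))))

  coeff : G.Carrier → Elem → Carrier
  coeff a [] = 0#
  coeff a ((r , b) ∷ xs) = (if does (b ≟G a) then r else 0#) + coeff a xs

  coeff-resp : ∀ a {xs ys} → xs ∼ ys → coeff a xs ≈ coeff a ys
  coeff-resp a ∼-refl = refl
  coeff-resp a (∼-sym p) = sym (coeff-resp a p)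
  coeff-resp a (∼-trans p q) = trans (coeff-resp a p) (coeff-resp a q)
  coeff-resp a (∼-cons {h = b} {h' = b′} r≈r′ b≈b′ p) with b ≟G a | b′ ≟G a
  ... | yes _ | yes _ = +-cong r≈r′ (coeff-resp a p)
  ... | no _ | no _ = +-congˡ (coeff-resp a p)
  ... | yes b≈a | no b′≉a = ⊥-elim (b′≉a (G.trans (G.sym b≈b′) b≈a))
  ... | no b≉a | yes b′≈a = ⊥-elim (b≉a (G.trans b≈b′ b′≈a))
  coeff-resp a ∼-swap = x∙yz≈y∙xz _ _ _
  coeff-resp a (∼-merge {r} {r′} {b} {xs}) with b ≟G a
  ... | yes _ = sym (+-assoc r r′ _)
  ... | no _ = +-identityˡ _
  coeff-resp a (∼-zero {b} {xs}) with b ≟G a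
  ... | yes _ = +-identityˡ _
  ... | no _ = +-identityˡ _

  coeff-absent : ∀ {h′} (cs : Fin h′ → Carrier) (bs : Fin h′ → G.Carrier) a → (∀ i → ¬ (bs i G.≈ a)) →
                 coeff a (tabulate (λ i → cs i , bs i)) ≈ 0#
  coeff-absent {zero} cs bs a bs≉a = refl
  coeff-absent {suc h′} cs bs a bs≉a with bs Fin.zero ≟G a
  ... | yes b₀≈a = ⊥-elim (bs≉a Fin.zero b₀≈a)
  ... | no _ = trans (+-identityˡ _) (coeff-absent (λ i → cs (Fin.suc i)) (λ i → bs (Fin.suc i)) a (λ i → bs≉a (Fin.suc i)))

  coeff-tabulate : ∀ {h′} (cs : Fin h′ → Carrier) (bs : Fin h′ → G.Carrier) → (∀ i j → bs i G.≈ bs j → i ≡ j) →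
                   ∀ i → coeff (bs i) (tabulate (λ i → cs i , bs i)) ≈ cs i
  coeff-tabulate {suc h′} cs bs bs-injective Fin.zero with bs Fin.zero ≟G bs Fin.zero
  ... | no b₀≉b₀ = ⊥-elim (b₀≉b₀ G.refl)
  ... | yes _ = trans (+-congˡ (coeff-absent (λ i → cs (Fin.suc i)) (λ i → bs (Fin.suc i)) (bs Fin.zero)
                         (λ j e → case bs-injective _ _ e of λ ()))) (+-identityʳ _)
  coeff-tabulate {suc h′} cs bs bs-injective (Fin.suc i) with bs Fin.zero ≟G bs (Fin.suc i)
  ... | yes e = case bs-injective _ _ e of λ ()
  ... | no _ = trans (+-identityˡ _) (coeff-tabulate (λ i → cs (Fin.suc i)) (λ i → bs (Fin.suc i))
                      (λ i j e → Finₚ.suc-injective (bs-injective _ _ e)) i)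

  combination-injective : ∀ {cs cs′} → combination cs ∼ combination cs′ → ∀ i → cs i ≈ cs′ i
  combination-injective {cs} {cs′} e i = begin
      cs i                                ≈⟨ coeff-tabulate cs basis basis-injective i ⟨
      coeff (basis i) (combination cs)    ≈⟨ coeff-resp (basis i) e ⟩
      coeff (basis i) (combination cs′)   ≈⟨ coeff-tabulate cs′ basis basis-injective i ⟩
      cs′ i                               ∎
    where open SetoidReasoning setoid

-- The quotient R/N and products of elements of N

module Ideal {c ℓ p} (R : Ring c ℓ) {N : Pred (Ring.Carrier R) p} (I : RingNotions.IsIdeal R N) where
  open Ring R
  open RingNotions R
  open IsIdeal I
  open RingProperties R using (⁻¹-anti-homo‿-; -‿+-comm; x[y-z]≈xy-xz; [y-z]x≈yx-zx; -0#≈0#)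
  open CommSemigroupProperties +-commutativeSemigroup using (interchange)
  open SetoidReasoning setoid

  infix 4 _≈N_
  _≈N_ : Carrier → Carrier → Set p
  _≈N_ = N ≈/_

  ≈⇒≈N : ∀ {x y} → x ≈ y → x ≈N y
  ≈⇒≈N {x} {y} x≈y = resp (sym (trans (+-congʳ x≈y) (-‿inverseʳ y))) zero∈

  ≈N-sym : ∀ {x y} → x ≈N y → y ≈N x
  ≈N-sym {x} {y} x≈y = resp (⁻¹-anti-homo‿- x y) (-∈ x≈y)

  [x-y]+[y-z]≈x-z : ∀ x y z → (x - y) + (y - z) ≈ x - z
  [x-y]+[y-z]≈x-z x y z = begin
    (x - y) + (y - z)     ≈⟨ +-assoc x (- y) (y - z) ⟩
    x + (- y + (y - z))   ≈⟨ +-congˡ (+-assoc (- y) y (- z)) ⟨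
    x + ((- y + y) - z)   ≈⟨ +-congˡ (+-congʳ (-‿inverseˡ y)) ⟩
    x + (0# - z)          ≈⟨ +-congˡ (+-identityˡ (- z)) ⟩
    x - z                 ∎

  ≈N-trans : ∀ {x y z} → x ≈N y → y ≈N z → x ≈N z
  ≈N-trans {x} {y} {z} x≈y y≈z = resp ([x-y]+[y-z]≈x-z x y z) (+∈ x≈y y≈z)

  +-cong-≈N : ∀ {x y u v} → x ≈N y → u ≈N v → (x + u) ≈N (y + v)
  +-cong-≈N {x} {y} {u} {v} x≈y u≈v = resp (sym (begin
    (x + u) - (y + v)       ≈⟨ +-congˡ (-‿+-comm y v) ⟨
    (x + u) + (- y + - v)   ≈⟨ interchange x u (- y) (- v) ⟩
    (x - y) + (u - v)       ∎)) (+∈ x≈y u≈v)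

  -‿cong-≈N : ∀ {x y} → x ≈N y → (- x) ≈N (- y)
  -‿cong-≈N {x} {y} x≈y = resp (sym (-‿+-comm x (- y))) (-∈ x≈y)

  *-cong-≈N : ∀ {x y u v} → x ≈N y → u ≈N v → (x * u) ≈N (y * v)
  *-cong-≈N {x} {y} {u} {v} x≈y u≈v =
    resp (trans (+-cong (x[y-z]≈xy-xz x u v) ([y-z]x≈yx-zx v x y)) ([x-y]+[y-z]≈x-z (x * u) (x * v) (y * v)))
      (+∈ (*ˡ∈ x u≈v) (*ʳ∈ v x≈y))

  quotient : Ring c p
  quotient = record
    { Carrier = Carrier ; _≈_ = _≈N_ ; _+_ = _+_ ; _*_ = _*_ ; -_ = -_ ; 0# = 0# ; 1# = 1#
    ; isRing = record
      { +-isAbelianGroup = record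
        { isGroup = record
          { isMonoid = record
            { isSemigroup = record
              { isMagma = record
                { isEquivalence = record { refl = ≈⇒≈N refl ; sym = ≈N-sym ; trans = ≈N-trans }
                ; ∙-cong = +-cong-≈N }
              ; assoc = λ x y z → ≈⇒≈N (+-assoc x y z) }
            ; identity = (λ x → ≈⇒≈N (+-identityˡ x)) , (λ x → ≈⇒≈N (+-identityʳ x)) }
          ; inverse = (λ x → ≈⇒≈N (-‿inverseˡ x)) , (λ x → ≈⇒≈N (-‿inverseʳ x))
          ; ⁻¹-cong = -‿cong-≈N }
        ; comm = λ x y → ≈⇒≈N (+-comm x y) }
      ; *-cong = *-cong-≈N
      ; *-assoc = λ x y z → ≈⇒≈N (*-assoc x y z)
      ; *-identity = (λ x → ≈⇒≈N (*-identityˡ x)) , (λ x → ≈⇒≈N (*-identityʳ x))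
      ; distrib = (λ x y z → ≈⇒≈N (distribˡ x y z)) , (λ x y z → ≈⇒≈N (distribʳ x y z)) } }

  ≈N-0#⇒∈ : ∀ {x} → x ≈N 0# → N x
  ≈N-0#⇒∈ {x} = resp (trans (+-congˡ -0#≈0#) (+-identityʳ x))

  -- Stands in for Nʲ: coefficients are tracked one at a time, so single products suffice.
  ProductOfAtLeast : ℕ → Pred Carrier (c ⊔ ℓ ⊔ p)
  ProductOfAtLeast j r = Σ ℕ λ m → j ℕ.≤ m × Σ (Vec.Vec Carrier m) λ v → VecAll.All N v × r ≈ prodVec v

  prodVec-++ : ∀ {m n} (v : Vec.Vec Carrier m) (u : Vec.Vec Carrier n) → prodVec (v Vec.++ u) ≈ prodVec v * prodVec u
  prodVec-++ Vec.[] u = sym (*-identityˡ _)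
  prodVec-++ (a Vec.∷ v) u = trans (*-congˡ (prodVec-++ v u)) (sym (*-assoc a _ _))

  ProductOfAtLeast-* : ∀ {a b r r′} → ProductOfAtLeast a r → ProductOfAtLeast b r′ → ProductOfAtLeast (a ℕ.+ b) (r * r′)
  ProductOfAtLeast-* (m , a≤m , v , Nv , r≈v) (m′ , b≤m′ , u , Nu , r′≈u) =
    m ℕ.+ m′ , ℕₚ.+-mono-≤ a≤m b≤m′ , v Vec.++ u , VecAllₚ.++⁺ Nv Nu , trans (*-cong r≈v r′≈u) (sym (prodVec-++ v u))

  ProductOfAtLeast-mono : ∀ {a b r} → b ℕ.≤ a → ProductOfAtLeast a r → ProductOfAtLeast b r
  ProductOfAtLeast-mono b≤a (m , a≤m , rest) = m , ℕₚ.≤-trans b≤a a≤m , rest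

  ∈⇒ProductOfAtLeast1 : ∀ {r} → N r → ProductOfAtLeast 1 r
  ∈⇒ProductOfAtLeast1 {r} Nr = 1 , s≤s z≤n , r Vec.∷ Vec.[] , Nr VecAll.∷ VecAll.[] , sym (*-identityʳ r)

  -- the tail of a product of at least k factors is absorbed into its k-th factor
  prodVec-shorten : ∀ k {m} (v : Vec.Vec Carrier m) → VecAll.All N v → k ℕ.< m →
                    Σ (Vec.Vec Carrier (suc k)) λ u → VecAll.All N u × prodVec v ≈ prodVec u
  prodVec-shorten zero (a Vec.∷ v) (Na VecAll.∷ Nv) _ =
    prodVec (a Vec.∷ v) Vec.∷ Vec.[] , *ʳ∈ (prodVec v) Na VecAll.∷ VecAll.[] , sym (*-identityʳ _)
  prodVec-shorten (suc k) (a Vec.∷ v) (Na VecAll.∷ Nv) (s≤s k<m) with prodVec-shorten k v Nv k<m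
  ... | u , Nu , v≈u = a Vec.∷ u , Na VecAll.∷ Nu , *-congˡ v≈u

  PowZero-InPow : ∀ {k} → PowZero N k → ∀ {r} (v : Vec.Vec Carrier k) → VecAll.All N v → r ≈ prodVec v → r ≈ 0#
  PowZero-InPow N^k≈0 v Nv r≈v = N^k≈0 _ (v ∷ [] , Nv All.∷ All.[] , trans r≈v (sym (+-identityʳ _)))

  ProductOfAtLeast⇒≈0 : ∀ {k r} → PowZero N k → ProductOfAtLeast k r → r ≈ 0#
  ProductOfAtLeast⇒≈0 {zero} {r} N⁰≈0 _ = begin
      r        ≈⟨ *-identityʳ r ⟨
      r * 1#   ≈⟨ *-congˡ (PowZero-InPow N⁰≈0 Vec.[] VecAll.[] refl) ⟩
      r * 0#   ≈⟨ zeroʳ r ⟩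
      0#       ∎
  ProductOfAtLeast⇒≈0 {suc k} N^k≈0 (m , k<m , v , Nv , r≈v) with prodVec-shorten k v Nv k<m
  ... | u , Nu , v≈u = PowZero-InPow N^k≈0 u Nu (trans r≈v v≈u)

-- Units of RG modulo a nilpotent ideal

module ModuloNilpotentIdeal {c ℓ g ℓg p} (G : Group g ℓg) (R : Ring c ℓ) {N : Pred (Ring.Carrier R) p}
                            (I : RingNotions.IsIdeal R N) where
  open Ring R hiding (zero)
  open RingNotions R
  open IsIdeal I
  open Ideal R I
  open GroupRing R G
  private module G = Group G
  module QG = GroupRing quotient G
  module CharQ = Setup.CharQ G R N

  reduce-∼ : ∀ {x y} → x ∼ y → x QG.∼ y
  reduce-∼ ∼-refl = QG.∼-refl
  reduce-∼ (∼-sym p) = QG.∼-sym (reduce-∼ p)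
  reduce-∼ (∼-trans p q) = QG.∼-trans (reduce-∼ p) (reduce-∼ q)
  reduce-∼ (∼-cons a b p) = QG.∼-cons (≈⇒≈N a) b (reduce-∼ p)
  reduce-∼ ∼-swap = QG.∼-swap
  reduce-∼ ∼-merge = QG.∼-merge
  reduce-∼ ∼-zero = QG.∼-zero

  reduce-IsUnit : ∀ {x} → IsUnit x → QG.IsUnit x
  reduce-IsUnit (y , xy∼1 , yx∼1) = y , reduce-∼ xy∼1 , reduce-∼ yx∼1

  reduce-^ : ∀ x n → (x QG.^ n) ≡ (x ^ n)
  reduce-^ x zero = ≡.refl
  reduce-^ x (suc n) = ≡.cong (x ·_) (reduce-^ x n)

  x≈y+[x-y] : ∀ x y → x ≈ y + (x - y)
  x≈y+[x-y] x y = sym (begin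
     y + (x - y)     ≈⟨ +-comm y _ ⟩
     (x - y) + y     ≈⟨ +-assoc x (- y) y ⟩
     x + (- y + y)   ≈⟨ +-congˡ (-‿inverseˡ y) ⟩
     x + 0#          ≈⟨ +-identityʳ x ⟩
     x               ∎)
    where open SetoidReasoning setoid

  CongruentModNG : Elem → Elem → Set (c ⊔ ℓ ⊔ g ⊔ ℓg ⊔ p)
  CongruentModNG xs ys = Σ Elem λ a → Σ Elem λ b → CoeffsIn N a × CoeffsIn N b × (xs ++ a) ∼ (ys ++ b)

  lift-∼ : ∀ {xs ys} → xs QG.∼ ys → CongruentModNG xs ys
  lift-∼ QG.∼-refl = [] , [] , All.[] , All.[] , ∼-refl
  lift-∼ (QG.∼-sym p) with lift-∼ p
  ... | a , b , Na , Nb , q = b , a , Nb , Na , ∼-sym q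
  lift-∼ (QG.∼-trans {xs} {ys} {zs} p p′) with lift-∼ p | lift-∼ p′
  ... | a , b , Na , Nb , q | a′ , b′ , Na′ , Nb′ , q′ =
    a ++ a′ , b′ ++ b , Allₚ.++⁺ Na Na′ , Allₚ.++⁺ Nb′ Nb , (begin
      xs ++ (a ++ a′)   ≈⟨ ++-assoc xs a a′ ⟨
      (xs ++ a) ++ a′   ≈⟨ ++-congʳ a′ q ⟩
      (ys ++ b) ++ a′   ≈⟨ ++-assoc ys b a′ ⟩
      ys ++ (b ++ a′)   ≈⟨ ++-congˡ ys (++-comm b a′) ⟩
      ys ++ (a′ ++ b)   ≈⟨ ++-assoc ys a′ b ⟨
      (ys ++ a′) ++ b   ≈⟨ ++-congʳ b q′ ⟩
      (zs ++ b′) ++ b   ≈⟨ ++-assoc zs b′ b ⟩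
      zs ++ (b′ ++ b)   ∎)
    where open ∼-Reasoning
  lift-∼ (QG.∼-cons {r} {r′} {h} {h′} {xs} {ys} r≈r′ h≈h′ p) with lift-∼ p
  ... | a , b , Na , Nb , q =
    a , (r - r′ , h′) ∷ b , Na , r≈r′ All.∷ Nb ,
    ∼-trans (∼-cons (x≈y+[x-y] r r′) h≈h′ q) (∼-sym (∼-trans (∷-congʳ _ (++-∷-move ys (r - r′ , h′) b)) ∼-merge))
  lift-∼ QG.∼-swap = [] , [] , All.[] , All.[] , ∼-swap
  lift-∼ QG.∼-merge = [] , [] , All.[] , All.[] , ∼-merge
  lift-∼ QG.∼-zero = [] , [] , All.[] , All.[] , ∼-zero

  CoeffsIn-neg : ∀ {xs} → CoeffsIn N xs → CoeffsIn N (neg xs)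
  CoeffsIn-neg All.[] = All.[]
  CoeffsIn-neg (Nr All.∷ Nxs) = -∈ Nr All.∷ CoeffsIn-neg Nxs

  lift-∼-one : ∀ {x} → x QG.∼ QG.one → OnePlus N x
  lift-∼-one {x} x∼1 with lift-∼ x∼1
  ... | a , b , Na , Nb , x+a∼1+b = b ++ neg a , Allₚ.++⁺ Nb (CoeffsIn-neg Na) , (begin
      x                     ≡⟨ Listₚ.++-identityʳ x ⟨
      x ++ []               ≈⟨ ++-congˡ x (∼-sym (++-inverseʳ a)) ⟩
      x ++ (a ++ neg a)     ≈⟨ ++-assoc x a _ ⟨
      (x ++ a) ++ neg a     ≈⟨ ++-congʳ (neg a) x+a∼1+b ⟩
      (one ++ b) ++ neg a   ≈⟨ ++-assoc one b _ ⟩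
      one ++ (b ++ neg a)   ∎)
    where open ∼-Reasoning

  IsUnitsExponent : ℕ → Set (c ⊔ g ⊔ ℓg ⊔ p)
  IsUnitsExponent w = ∀ y → QG.IsUnit y → (y QG.^ w) QG.∼ QG.one

  card⇒IsUnitsExponent : ∀ {n} → HasCard QG._∼_ QG.IsUnit n → IsUnitsExponent n
  card⇒IsUnitsExponent card y =
    FiniteSubmonoid.^-size≈one quotient G QG.IsUnit QG.IsUnit-resp id QG.IsUnit-one QG.IsUnit-· card

  ^-exponent-OnePlus : ∀ w → IsUnitsExponent w → ∀ {x} → IsUnit x → OnePlus N (x ^ w)
  ^-exponent-OnePlus w exponent {x} x-unit =
    lift-∼-one (≡.subst (QG._∼ QG.one) (reduce-^ x w) (exponent x (reduce-IsUnit x-unit)))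

  concat-replicate≈scale : ∀ n y → concat (replicate n y) ∼ scale (CharQ.natMul n) G.ε y
  concat-replicate≈scale zero y = ∼-sym (scale-zero G.ε y)
  concat-replicate≈scale (suc n) y =
    ∼-trans (++-cong (∼-sym (scale-identity y)) (concat-replicate≈scale n y)) (scale-distrib-+ 1# _ G.ε y)

  CoeffsIn-∈⇒ProductOfAtLeast1 : ∀ {xs} → CoeffsIn N xs → CoeffsIn (ProductOfAtLeast 1) xs
  CoeffsIn-∈⇒ProductOfAtLeast1 = All.map ∈⇒ProductOfAtLeast1

  CoeffsIn-PowZero⇒∼[] : ∀ {k xs} → PowZero N k → CoeffsIn (ProductOfAtLeast k) xs → xs ∼ []
  CoeffsIn-PowZero⇒∼[] N^k≈0 = CoeffsIn-≈0⇒∼[] ∘ All.map (ProductOfAtLeast⇒≈0 N^k≈0)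

  module _ {s} (s∈N : N (CharQ.natMul s)) where

    -- With s·1 ∈ N, the linear term s·y of (1 + y)ˢ drops one level deeper in the filtration.
    OnePlus-^-characteristic : ∀ {j x} → 1 ℕ.≤ j →
                               OnePlus (ProductOfAtLeast j) x → OnePlus (ProductOfAtLeast (suc j)) (x ^ s)
    OnePlus-^-characteristic {suc j} {x} _ (y , Py , x∼1+y)
      with one++-^ {Q = ProductOfAtLeast (2 ℕ.+ j)}
             (λ Pa Pb → ProductOfAtLeast-mono (s≤s (ℕₚ.m≤n+m (suc j) j)) (ProductOfAtLeast-* Pa Pb))
             (λ Pa Qb → ProductOfAtLeast-mono (ℕₚ.m≤n+m (2 ℕ.+ j) (suc j)) (ProductOfAtLeast-* Pa Qb))
             Py s
    ... | t , Qt , [1+y]ˢ∼1+sy+t =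
      scale (CharQ.natMul s) G.ε y ++ t ,
      Allₚ.++⁺ (CoeffsIn-scale _ G.ε y (ProductOfAtLeast-* (∈⇒ProductOfAtLeast1 s∈N)) Py) Qt ,
      ∼-trans (^-cong s x∼1+y) (∼-trans [1+y]ˢ∼1+sy+t (++-congˡ one (++-congʳ t (concat-replicate≈scale s y))))

    OnePlus-^-characteristic-power : ∀ {x} → OnePlus N x → ∀ i → OnePlus (ProductOfAtLeast (suc i)) (x ^ (s ℕ.^ i))
    OnePlus-^-characteristic-power {x} (y , Ny , x∼1+y) zero =
      y , CoeffsIn-∈⇒ProductOfAtLeast1 Ny , ∼-trans (·-identityʳ x) x∼1+y
    OnePlus-^-characteristic-power {x} Nx (suc i) =
      OnePlus-resp (^-*-assoc x s (s ℕ.^ i)) (OnePlus-^-characteristic (s≤s z≤n) (OnePlus-^-characteristic-power Nx i))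

    OnePlus-^-characteristic-power≈one : ∀ {k} → PowZero N k → ∀ {x} → OnePlus N x → (x ^ (s ℕ.^ (k ∸ 1))) ∼ one
    OnePlus-^-characteristic-power≈one {k} N^k≈0 Nx with OnePlus-^-characteristic-power Nx (k ∸ 1)
    ... | y , Py , x^∼1+y = ∼-trans x^∼1+y (∼-trans (++-congˡ one (CoeffsIn-PowZero⇒∼[] N^k≈0
            (All.map (ProductOfAtLeast-mono (ℕₚ.m≤n+m∸n k 1)) Py))) (≡⇒∼ (Listₚ.++-identityʳ one)))

  characteristic∈N : ∀ {s} → CharQ.IsCharacteristic s → N (CharQ.natMul s)
  characteristic∈N (inj₁ (_ , s·1≈0 , _)) = ≈N-0#⇒∈ s·1≈0
  characteristic∈N (inj₂ (≡.refl , _)) = zero∈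

  module _ {k} (N^k≈0 : PowZero N k) where

    CoeffsIn-^ : ∀ {a} → CoeffsIn (ProductOfAtLeast 1) a → ∀ j → CoeffsIn (ProductOfAtLeast j) (a ^ j)
    CoeffsIn-^ Pa zero = (0 , z≤n , Vec.[] , VecAll.[] , refl) All.∷ All.[]
    CoeffsIn-^ {a} Pa (suc j) = CoeffsIn-· ProductOfAtLeast-* a (a ^ j) Pa (CoeffsIn-^ Pa j)

    OnePlus-IsUnit : ∀ {x} → OnePlus N x → IsUnit x
    OnePlus-IsUnit (t , Nt , x∼1+t) = IsUnit-resp (∼-sym x∼1+t) (one++-IsUnit t k
      (CoeffsIn-PowZero⇒∼[] N^k≈0 (CoeffsIn-^ (CoeffsIn-∈⇒ProductOfAtLeast1 (CoeffsIn-neg Nt)) k)))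

    OnePlus-N-· : ∀ {x y} → OnePlus N x → OnePlus N y → OnePlus N (x · y)
    OnePlus-N-· = OnePlus-· (λ Na _ → *ʳ∈ _ Na)

    OnePlus-one : OnePlus N one
    OnePlus-one = [] , All.[] , ≡⇒∼ (≡.sym (Listₚ.++-identityʳ one))

    module _ {m} (N-card : HasCard _≈_ N m) {h} (G-card : HasCard G._≈_ (λ _ → ⊤ {g}) h) where
      private
        enumN = proj₁ N-card
        enumN-∈ = proj₁ (proj₂ N-card)
        enumN-injective = proj₁ (proj₂ (proj₂ N-card))
        enumN-surjective = proj₂ (proj₂ (proj₂ N-card))
      open FiniteBasis R G (proj₁ G-card) (proj₁ (proj₂ (proj₂ G-card))) (λ a → proj₂ (proj₂ (proj₂ G-card)) a tt)

      -- a code lists, for each element of G, the index in N of the coefficient of 1 + y at it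
      decode : Fin (m ℕ.^ h) → Elem
      decode code = one ++ combination (λ i → enumN (finToFun code i))

      decode-OnePlus : ∀ code → OnePlus N (decode code)
      decode-OnePlus code = _ , CoeffsIn-combination (λ i → enumN-∈ (finToFun code i)) , ∼-refl

      decode-injective : ∀ code code′ → decode code ∼ decode code′ → code ≡ code′
      decode-injective code code′ e =
        finToFun-injective code code′ λ i → enumN-injective _ _ (combination-injective (++-cancelˡ one e) i)

      decode-surjective : ∀ x → OnePlus N x → Σ (Fin (m ℕ.^ h)) λ code → decode code ∼ x
      decode-surjective x (t , Nt , x∼1+t) with combination-complete N zero∈ +∈ Nt
      ... | cs , Ncs , cs∼t =
        funToFin digits , ∼-trans (++-congˡ one (∼-trans (combination-cong digits≈cs) cs∼t)) (∼-sym x∼1+t)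
        where
        digits : Fin h → Fin m
        digits i = proj₁ (enumN-surjective (cs i) (Ncs i))
        digits≈cs : ∀ i → enumN (finToFun (funToFin digits) i) ≈ cs i
        digits≈cs i = trans (reflexive (≡.cong enumN (Finₚ.finToFun-funToFin digits i)))
                            (proj₂ (enumN-surjective (cs i) (Ncs i)))

      OnePlus-card : HasCard _∼_ (OnePlus N) (m ℕ.^ h)
      OnePlus-card = decode , decode-OnePlus , decode-injective , decode-surjective

      OnePlus-^-card≈one : ∀ {x} → OnePlus N x → (x ^ (m ℕ.^ h)) ∼ one
      OnePlus-^-card≈one =
        FiniteSubmonoid.^-size≈one R G (OnePlus N) OnePlus-resp OnePlus-IsUnit OnePlus-one OnePlus-N-· OnePlus-card

      unit-^[exponent*|N|^|G|]≈one : ∀ n → IsUnitsExponent n → ∀ {x} → IsUnit x → (x ^ (n ℕ.* (m ℕ.^ h))) ∼ one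
      unit-^[exponent*|N|^|G|]≈one n exponent {x} x-unit =
        ∼-trans (^-*-comm x n (m ℕ.^ h)) (OnePlus-^-card≈one (^-exponent-OnePlus n exponent x-unit))

    unit-^[exponent*s^[k∸1]]≈one : ∀ {s} → CharQ.IsCharacteristic s → ∀ w → IsUnitsExponent w →
                                   ∀ {x} → IsUnit x → (x ^ (w ℕ.* (s ℕ.^ (k ∸ 1)))) ∼ one
    unit-^[exponent*s^[k∸1]]≈one {s} s-char w exponent {x} x-unit =
      ∼-trans (^-*-comm x w (s ℕ.^ (k ∸ 1)))
        (OnePlus-^-characteristic-power≈one (characteristic∈N s-char) N^k≈0 (^-exponent-OnePlus w exponent x-unit))

open import Data.Nat using (_*_) renaming (_^_ to _^ℕ_)

corollary4p4 : ∀ {c ℓ g ℓg p} (G : Group g ℓg) (R : Ring c ℓ) (N : Pred (Ring.Carrier R) p) →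
    RingNotions.IsIdeal R N →
    (k : ℕ) → RingNotions.IsNilpotencyIndex R N k →
    (s : ℕ) → Setup.CharQ.IsCharacteristic G R N s →
    let open Setup G R N in
    -- (1)
    ((w : ℕ) → (∀ y → QG.IsUnit y → QG._∼_ (QG._^_ y w) QG.one) →
       ∀ x → RG.IsUnit x → RG._∼_ (RG._^_ x (w * (s ^ℕ (k ∸ 1)))) RG.one)
    ×
    -- (2)
    ((n : ℕ) → HasCard QG._∼_ QG.IsUnit n →
       ∀ x → RG.IsUnit x → RG._∼_ (RG._^_ x (n * (s ^ℕ (k ∸ 1)))) RG.one)
    ×
    -- (3)
    (Finite RG._∼_ RG.IsUnit →
       (n m h : ℕ) → HasCard QG._∼_ QG.IsUnit n →
       HasCard (Ring._≈_ R) N m → HasCard (Group._≈_ G) (λ _ → ⊤ {g}) h →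
       ∀ x → RG.IsUnit x → RG._∼_ (RG._^_ x (n * (m ^ℕ h))) RG.one)
corollary4p4 G R N I k (N^k≈0 , _) s s-char =
    (λ w exponent x → unit-^[exponent*s^[k∸1]]≈one N^k≈0 s-char w exponent)
  , (λ n card x → unit-^[exponent*s^[k∸1]]≈one N^k≈0 s-char n (card⇒IsUnitsExponent card))
  , (λ _ n m h card N-card G-card x →
       unit-^[exponent*|N|^|G|]≈one N^k≈0 N-card G-card n (card⇒IsUnitsExponent card))
  where open ModuloNilpotentIdeal G R I
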